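{- In $\lambda_{\mathrm{eff}}^{+}$ the following equation is derivable: $\mathtt{handle}\ (\mathtt{case}\ V\ \mathtt{of}\ \{\iota_1x_1\mapsto M_1;\ \iota_2x_2\mapsto M_2\})\ \mathtt{with}\ H\ \mathtt{to}\ y.N = \mathtt{case}\ V\ \mathtt{of}\ \{\iota_1x_1\mapsto\mathtt{handle}\ M_1\ \mathtt{with}\ H\ \mathtt{to}\ y.N;\ \iota_2x_2\mapsto\mathtt{handle}\ M_2\ \mathtt{with}\ H\ \mathtt{to}\ y.N\}$.
   Context: $\lambda_{\mathrm{eff}}$ is a fine-grain call-by-value calculus with values $x,\lambda x.M,\langle\dots\rangle,\pi_iV$, computations $V\,W$, $\mathtt{return}\ V$, $\mathtt{let}\ x\Leftarrow M\ \mathtt{in}\ N$, $\mathtt{op}(V)$, $\mathtt{handle}\ M\ \mathtt{with}\ H\ \mathtt{to}\ x.N$, handlers finite sets of clauses $\mathtt{op}(x,k)\mapsto M_{\mathtt{op}}$, computation types $A!\Sigma$ with signatures finite sets of entries $\mathtt{op}:A_{\mathtt{op}}\to B_{\mathtt{op}}$ (operation-signature arrow); its equational theory is the least congruence (in particular closed under substitution of values) containing $\beta\eta$ for functions and products, monad laws, and handler laws. $\lambda_{\mathrm{eff}}^{+}$ extends it with sum types $A+B$, value injections $\iota_1V,\iota_2V$, and computation $\mathtt{case}\ V\ \mathtt{of}\ \{\iota_1x\mapsto M;\ \iota_2y\mapsto N\}$, with equations $\mathtt{case}\ \iota_iV\ \mathtt{of}\ \{\iota_1x\mapsto M_1;\iota_2x\mapsto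 M_2\}=M_i[V/x]$ and the $\eta$-law $\mathtt{case}\ V\ \mathtt{of}\ \{\iota_1y\mapsto M[\iota_1y/x];\iota_2z\mapsto M[\iota_2z/x]\}=M[V/x]$; no additional equations about handlers and case are added. -}

module Defs where

open import Data.Nat using (ℕ; zero; suc)
open import Data.Fin using (Fin; zero; suc)
open import Data.List using (List; []; _∷_; map; upTo; length)
open import Data.List.Membership.Propositional using (_∈_; _∉_)
open import Data.List.Relation.Unary.Unique.Propositional using (Unique)
open import Data.Vec using (Vec; lookup) renaming (_∷_ to _,,_)
open import Data.Product using (_×_; _,_; proj₁; ∃; ∃-syntax)
open import Data.Sum using (_⊎_)

OpName : Set
OpName = ℕ

infixr 6 _⇒_
infixr 8 _⊕_
infix  7 _!_

mutual
  data VType : Set where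
    base : ℕ → VType
    _⇒_  : VType → CType → VType
    Π    : List VType → VType                -- n-ary products (Π [] is unit)
    _⊕_  : VType → VType → VType

  data CType : Set where
    _!_ : VType → List (OpName × VType × VType) → CType

Sig : Set
Sig = List (OpName × VType × VType)

-- Well-scoped syntax (de Bruijn indices; Fin n = variables in scope)

mutual
  data Val (n : ℕ) : Set where
    var  : Fin n → Val n
    lam  : Comp (suc n) → Val n
    tup  : List (Val n) → Val n
    proj : ℕ → Val n → Val n                          -- π_i V (0-based)
    inl  : Val n → Val n
    inr  : Val n → Val n

  data Comp (n : ℕ) : Set where
    app    : Val n → Val n → Comp n
    ret    : Val n → Comp n
    lett   : Comp n → Comp (suc n) → Comp n
    opc    : OpName → Val n → Comp n
    -- handle M with H to y.N ; a handler is a finite list of clauses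
    -- op(x,k) ↦ M_op, with M_op in scope (k = var 0, x = var 1)
    handle : Comp n → List (OpName × Comp (suc (suc n))) → Comp (suc n) → Comp n
    case   : Val n → Comp (suc n) → Comp (suc n) → Comp n

Handler : ℕ → Set
Handler n = List (OpName × Comp (suc (suc n)))

names : ∀ {n} → Handler n → List OpName
names H = map proj₁ H

Ren : ℕ → ℕ → Set
Ren n m = Fin n → Fin m

liftR : ∀ {n m} → Ren n m → Ren (suc n) (suc m)
liftR ρ zero    = zero
liftR ρ (suc i) = suc (ρ i)

mutual
  renV : ∀ {n m} → Ren n m → Val n → Val m
  renV ρ (var i)    = var (ρ i)
  renV ρ (lam M)    = lam (renC (liftR ρ) M)
  renV ρ (tup Vs)   = tup (renVs ρ Vs)
  renV ρ (proj i V) = proj i (renV ρ V)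
  renV ρ (inl V)    = inl (renV ρ V)
  renV ρ (inr V)    = inr (renV ρ V)

  renVs : ∀ {n m} → Ren n m → List (Val n) → List (Val m)
  renVs ρ []       = []
  renVs ρ (V ∷ Vs) = renV ρ V ∷ renVs ρ Vs

  renC : ∀ {n m} → Ren n m → Comp n → Comp m
  renC ρ (app V W)      = app (renV ρ V) (renV ρ W)
  renC ρ (ret V)        = ret (renV ρ V)
  renC ρ (lett M N)     = lett (renC ρ M) (renC (liftR ρ) N)
  renC ρ (opc op V)     = opc op (renV ρ V)
  renC ρ (handle M H N) = handle (renC ρ M) (renH ρ H) (renC (liftR ρ) N)
  renC ρ (case V M N)   = case (renV ρ V) (renC (liftR ρ) M) (renC (liftR ρ) N)

  renH : ∀ {n m} → Ren n m → Handler n → Handler m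
  renH ρ []             = []
  renH ρ ((op , M) ∷ H) = (op , renC (liftR (liftR ρ)) M) ∷ renH ρ H

Sub : ℕ → ℕ → Set
Sub n m = Fin n → Val m

liftS : ∀ {n m} → Sub n m → Sub (suc n) (suc m)
liftS σ zero    = var zero
liftS σ (suc i) = renV suc (σ i)

mutual
  subV : ∀ {n m} → Sub n m → Val n → Val m
  subV σ (var i)    = σ i
  subV σ (lam M)    = lam (subC (liftS σ) M)
  subV σ (tup Vs)   = tup (subVs σ Vs)
  subV σ (proj i V) = proj i (subV σ V)
  subV σ (inl V)    = inl (subV σ V)
  subV σ (inr V)    = inr (subV σ V)

  subVs : ∀ {n m} → Sub n m → List (Val n) → List (Val m)
  subVs σ []       = []
  subVs σ (V ∷ Vs) = subV σ V ∷ subVs σ Vs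

  subC : ∀ {n m} → Sub n m → Comp n → Comp m
  subC σ (app V W)      = app (subV σ V) (subV σ W)
  subC σ (ret V)        = ret (subV σ V)
  subC σ (lett M N)     = lett (subC σ M) (subC (liftS σ) N)
  subC σ (opc op V)     = opc op (subV σ V)
  subC σ (handle M H N) = handle (subC σ M) (subH σ H) (subC (liftS σ) N)
  subC σ (case V M N)   = case (subV σ V) (subC (liftS σ) M) (subC (liftS σ) N)

  subH : ∀ {n m} → Sub n m → Handler n → Handler m
  subH σ []             = []
  subH σ ((op , M) ∷ H) = (op , subC (liftS (liftS σ)) M) ∷ subH σ H

single : ∀ {n} → Val n → Sub (suc n) n
single V zero    = V
single V (suc i) = var i

_[_] : ∀ {n} → Comp (suc n) → Val n → Comp n
M [ V ] = subC (single V) M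

-- weakening under one binder: add a fresh variable just outside var 0
wk₁ : ∀ {n} → Comp (suc n) → Comp (suc (suc n))
wk₁ = renC (liftR suc)

wkV : ∀ {n} → Val n → Val (suc n)
wkV = renV suc

wkH : ∀ {n} → Handler n → Handler (suc n)
wkH = renH suc

-- M[ι₁ y / x] and M[ι₂ z / x]  (the new bound variable replaces x = var 0)
inlSub inrSub : ∀ {n} → Sub (suc n) (suc n)
inlSub zero    = inl (var zero)
inlSub (suc i) = var (suc i)
inrSub zero    = inr (var zero)
inrSub (suc i) = var (suc i)

-- M_op[V/x, (λx. handle M with H to y.N)/k]
opSub : ∀ {n} → Val n → Comp (suc n) → Handler n → Comp (suc n) → Sub (suc (suc n)) n
opSub V M H N zero          = lam (handle M (wkH H) (wk₁ N))
opSub V M H N (suc zero)    = V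
opSub V M H N (suc (suc i)) = var i

projs : ∀ {n} → Val n → ℕ → List (Val n)
projs V k = map (λ i → proj i V) (upTo k)

data _[_]≔_ {A : Set} : List A → ℕ → A → Set where
  here  : ∀ {x xs} → (x ∷ xs) [ 0 ]≔ x
  there : ∀ {x xs i y} → xs [ i ]≔ y → (x ∷ xs) [ suc i ]≔ y

Ctx : ℕ → Set
Ctx n = Vec VType n

infix 4 _⊢v_∶_ _⊢vs_∶_ _⊢c_∶_ _⊢h_∶_⇒_

mutual
  data _⊢v_∶_ {n} (Γ : Ctx n) : Val n → VType → Set where
    tvar  : ∀ i → Γ ⊢v var i ∶ lookup Γ i
    tlam  : ∀ {A C M} → (A ,, Γ) ⊢c M ∶ C → Γ ⊢v lam M ∶ A ⇒ C
    ttup  : ∀ {Vs As} → Γ ⊢vs Vs ∶ As → Γ ⊢v tup Vs ∶ Π As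
    tproj : ∀ {V As i A} → Γ ⊢v V ∶ Π As → As [ i ]≔ A → Γ ⊢v proj i V ∶ A
    tinl  : ∀ {V A B} → Γ ⊢v V ∶ A → Γ ⊢v inl V ∶ A ⊕ B
    tinr  : ∀ {V A B} → Γ ⊢v V ∶ B → Γ ⊢v inr V ∶ A ⊕ B

  data _⊢vs_∶_ {n} (Γ : Ctx n) : List (Val n) → List VType → Set where
    []  : Γ ⊢vs [] ∶ []
    _∷_ : ∀ {V Vs A As} → Γ ⊢v V ∶ A → Γ ⊢vs Vs ∶ As → Γ ⊢vs (V ∷ Vs) ∶ (A ∷ As)

  data _⊢c_∶_ {n} (Γ : Ctx n) : Comp n → CType → Set where
    tapp    : ∀ {V W A C} → Γ ⊢v V ∶ A ⇒ C → Γ ⊢v W ∶ A → Γ ⊢c app V W ∶ C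
    tret    : ∀ {V A E} → Γ ⊢v V ∶ A → Γ ⊢c ret V ∶ A ! E
    tlet    : ∀ {M N A B E} → Γ ⊢c M ∶ A ! E → (A ,, Γ) ⊢c N ∶ B ! E
            → Γ ⊢c lett M N ∶ B ! E
    top     : ∀ {op V A B E} → (op , A , B) ∈ E → Γ ⊢v V ∶ A → Γ ⊢c opc op V ∶ B ! E
    thandle : ∀ {M H N A B E E'} → Γ ⊢c M ∶ A ! E → Γ ⊢h H ∶ E ⇒ B ! E'
            → (A ,, Γ) ⊢c N ∶ B ! E' → Γ ⊢c handle M H N ∶ B ! E'
    tcase   : ∀ {V M N A B C} → Γ ⊢v V ∶ A ⊕ B → (A ,, Γ) ⊢c M ∶ C → (B ,, Γ) ⊢c N ∶ C
            → Γ ⊢c case V M N ∶ C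

  -- H : A!E ⇒ B!E'  (the value type A plays no role in the clauses)
  data _⊢h_∶_⇒_ {n} (Γ : Ctx n) (H : Handler n) (E : Sig) : CType → Set where
    thandler : ∀ {B E'}
      → Unique (names H)                           -- a *set* of clauses
      → (∀ {op Mop} → (op , Mop) ∈ H →
           ∃[ Aop ] ∃[ Bop ] ((op , Aop , Bop) ∈ E × ((Bop ⇒ B ! E') ,, (Aop ,, Γ)) ⊢c Mop ∶ B ! E'))
      → (∀ {op Aop Bop} → (op , Aop , Bop) ∈ E → op ∉ names H → (op , Aop , Bop) ∈ E')
                                                   -- unhandled operations are forwarded
      → Γ ⊢h H ∶ E ⇒ B ! E'

-- Equational theory of λ_eff^+ : least congruence on well-typed terms,
-- closed under substitution of values, containing βη (functions,
-- products), monad laws, handler laws, and βη for sums.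

infix 4 _⊢v_≈_∶_ _⊢vs_≈_∶_ _⊢c_≈_∶_ _⊢h_≈_∶_⇒_ _⊢cl_≈_∶_⇒_

mutual
  data _⊢v_≈_∶_ : ∀ {n} → Ctx n → Val n → Val n → VType → Set where
    refl-v  : ∀ {n} {Γ : Ctx n} {V A} → Γ ⊢v V ∶ A → Γ ⊢v V ≈ V ∶ A
    sym-v   : ∀ {n} {Γ : Ctx n} {V W A} → Γ ⊢v V ≈ W ∶ A → Γ ⊢v W ≈ V ∶ A
    trans-v : ∀ {n} {Γ : Ctx n} {U V W A} → Γ ⊢v U ≈ V ∶ A → Γ ⊢v V ≈ W ∶ A → Γ ⊢v U ≈ W ∶ A
    cong-lam  : ∀ {n} {Γ : Ctx n} {M M' A C} → (A ,, Γ) ⊢c M ≈ M' ∶ C → Γ ⊢v lam M ≈ lam M' ∶ A ⇒ C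
    cong-tup  : ∀ {n} {Γ : Ctx n} {Vs Ws As} → Γ ⊢vs Vs ≈ Ws ∶ As → Γ ⊢v tup Vs ≈ tup Ws ∶ Π As
    cong-proj : ∀ {n} {Γ : Ctx n} {V W As i A} → Γ ⊢v V ≈ W ∶ Π As → As [ i ]≔ A
              → Γ ⊢v proj i V ≈ proj i W ∶ A
    cong-inl  : ∀ {n} {Γ : Ctx n} {V W A B} → Γ ⊢v V ≈ W ∶ A → Γ ⊢v inl V ≈ inl W ∶ A ⊕ B
    cong-inr  : ∀ {n} {Γ : Ctx n} {V W A B} → Γ ⊢v V ≈ W ∶ B → Γ ⊢v inr V ≈ inr W ∶ A ⊕ B
    sub-v : ∀ {n m} {Γ : Ctx n} {Δ : Ctx m} {σ : Sub n m} {V W A}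
          → (∀ i → Δ ⊢v σ i ∶ lookup Γ i) → Γ ⊢v V ≈ W ∶ A → Δ ⊢v subV σ V ≈ subV σ W ∶ A
    η-fun  : ∀ {n} {Γ : Ctx n} {V A C} → Γ ⊢v V ∶ A ⇒ C
           → Γ ⊢v lam (app (wkV V) (var zero)) ≈ V ∶ A ⇒ C
    β-prod : ∀ {n} {Γ : Ctx n} {Vs As i V A} → Γ ⊢vs Vs ∶ As → Vs [ i ]≔ V → As [ i ]≔ A
           → Γ ⊢v proj i (tup Vs) ≈ V ∶ A
    η-prod : ∀ {n} {Γ : Ctx n} {V As} → Γ ⊢v V ∶ Π As
           → Γ ⊢v tup (projs V (length As)) ≈ V ∶ Π As

  data _⊢vs_≈_∶_ : ∀ {n} → Ctx n → List (Val n) → List (Val n) → List VType → Set where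
    []  : ∀ {n} {Γ : Ctx n} → Γ ⊢vs [] ≈ [] ∶ []
    _∷_ : ∀ {n} {Γ : Ctx n} {V W Vs Ws A As} → Γ ⊢v V ≈ W ∶ A → Γ ⊢vs Vs ≈ Ws ∶ As
        → Γ ⊢vs (V ∷ Vs) ≈ (W ∷ Ws) ∶ (A ∷ As)

  data _⊢c_≈_∶_ : ∀ {n} → Ctx n → Comp n → Comp n → CType → Set where
    refl-c  : ∀ {n} {Γ : Ctx n} {M C} → Γ ⊢c M ∶ C → Γ ⊢c M ≈ M ∶ C
    sym-c   : ∀ {n} {Γ : Ctx n} {M N C} → Γ ⊢c M ≈ N ∶ C → Γ ⊢c N ≈ M ∶ C
    trans-c : ∀ {n} {Γ : Ctx n} {L M N C} → Γ ⊢c L ≈ M ∶ C → Γ ⊢c M ≈ N ∶ C → Γ ⊢c L ≈ N ∶ C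
    cong-app : ∀ {n} {Γ : Ctx n} {V V' W W' A C} → Γ ⊢v V ≈ V' ∶ A ⇒ C → Γ ⊢v W ≈ W' ∶ A
             → Γ ⊢c app V W ≈ app V' W' ∶ C
    cong-ret : ∀ {n} {Γ : Ctx n} {V V' A E} → Γ ⊢v V ≈ V' ∶ A → Γ ⊢c ret V ≈ ret V' ∶ A ! E
    cong-let : ∀ {n} {Γ : Ctx n} {M M' N N' A B E} → Γ ⊢c M ≈ M' ∶ A ! E
             → (A ,, Γ) ⊢c N ≈ N' ∶ B ! E → Γ ⊢c lett M N ≈ lett M' N' ∶ B ! E
    cong-op  : ∀ {n} {Γ : Ctx n} {op V V' A B E} → (op , A , B) ∈ E → Γ ⊢v V ≈ V' ∶ A
             → Γ ⊢c opc op V ≈ opc op V' ∶ B ! E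
    cong-handle : ∀ {n} {Γ : Ctx n} {M M' H H' N N' A B E E'} → Γ ⊢c M ≈ M' ∶ A ! E
             → Γ ⊢h H ≈ H' ∶ E ⇒ B ! E' → (A ,, Γ) ⊢c N ≈ N' ∶ B ! E'
             → Γ ⊢c handle M H N ≈ handle M' H' N' ∶ B ! E'
    cong-case : ∀ {n} {Γ : Ctx n} {V V' M M' N N' A B C} → Γ ⊢v V ≈ V' ∶ A ⊕ B
             → (A ,, Γ) ⊢c M ≈ M' ∶ C → (B ,, Γ) ⊢c N ≈ N' ∶ C
             → Γ ⊢c case V M N ≈ case V' M' N' ∶ C
    sub-c : ∀ {n m} {Γ : Ctx n} {Δ : Ctx m} {σ : Sub n m} {M N C}
          → (∀ i → Δ ⊢v σ i ∶ lookup Γ i) → Γ ⊢c M ≈ N ∶ C → Δ ⊢c subC σ M ≈ subC σ N ∶ C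
    β-fun : ∀ {n} {Γ : Ctx n} {M V A C} → (A ,, Γ) ⊢c M ∶ C → Γ ⊢v V ∶ A
          → Γ ⊢c app (lam M) V ≈ M [ V ] ∶ C
    let-ret   : ∀ {n} {Γ : Ctx n} {V N A B E} → Γ ⊢v V ∶ A → (A ,, Γ) ⊢c N ∶ B ! E
              → Γ ⊢c lett (ret V) N ≈ N [ V ] ∶ B ! E
    let-η     : ∀ {n} {Γ : Ctx n} {M A E} → Γ ⊢c M ∶ A ! E
              → Γ ⊢c lett M (ret (var zero)) ≈ M ∶ A ! E
    let-assoc : ∀ {n} {Γ : Ctx n} {M N P A B D E} → Γ ⊢c M ∶ A ! E → (A ,, Γ) ⊢c N ∶ B ! E
              → (B ,, Γ) ⊢c P ∶ D ! E
              → Γ ⊢c lett (lett M N) P ≈ lett M (lett N (wk₁ P)) ∶ D ! E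
    handle-ret : ∀ {n} {Γ : Ctx n} {V H N A B E E'} → Γ ⊢v V ∶ A → Γ ⊢h H ∶ E ⇒ B ! E'
               → (A ,, Γ) ⊢c N ∶ B ! E'
               → Γ ⊢c handle (ret V) H N ≈ N [ V ] ∶ B ! E'
    handle-op  : ∀ {n} {Γ : Ctx n} {op V M Mop H N Aop Bop A B E E'}
               → (op , Aop , Bop) ∈ E → Γ ⊢v V ∶ Aop → (Bop ,, Γ) ⊢c M ∶ A ! E
               → Γ ⊢h H ∶ E ⇒ B ! E' → (A ,, Γ) ⊢c N ∶ B ! E'
               → (op , Mop) ∈ H → ((Bop ⇒ B ! E') ,, (Aop ,, Γ)) ⊢c Mop ∶ B ! E'
               → Γ ⊢c handle (lett (opc op V) M) H N ≈ subC (opSub V M H N) Mop ∶ B ! E'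
    handle-fwd : ∀ {n} {Γ : Ctx n} {op V M H N Aop Bop A B E E'}
               → (op , Aop , Bop) ∈ E → Γ ⊢v V ∶ Aop → (Bop ,, Γ) ⊢c M ∶ A ! E
               → Γ ⊢h H ∶ E ⇒ B ! E' → (A ,, Γ) ⊢c N ∶ B ! E'
               → op ∉ names H
               → Γ ⊢c handle (lett (opc op V) M) H N
                    ≈ lett (opc op V) (handle M (wkH H) (wk₁ N)) ∶ B ! E'
    β-case₁ : ∀ {n} {Γ : Ctx n} {V M₁ M₂ A B C} → Γ ⊢v V ∶ A → (A ,, Γ) ⊢c M₁ ∶ C
            → (B ,, Γ) ⊢c M₂ ∶ C → Γ ⊢c case (inl V) M₁ M₂ ≈ M₁ [ V ] ∶ C
    β-case₂ : ∀ {n} {Γ : Ctx n} {V M₁ M₂ A B C} → Γ ⊢v V ∶ B → (A ,, Γ) ⊢c M₁ ∶ C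
            → (B ,, Γ) ⊢c M₂ ∶ C → Γ ⊢c case (inr V) M₁ M₂ ≈ M₂ [ V ] ∶ C
    η-case  : ∀ {n} {Γ : Ctx n} {V M A B C} → Γ ⊢v V ∶ A ⊕ B → ((A ⊕ B) ,, Γ) ⊢c M ∶ C
            → Γ ⊢c case V (subC inlSub M) (subC inrSub M) ≈ M [ V ] ∶ C

  data _⊢h_≈_∶_⇒_ {n} (Γ : Ctx n) (H H' : Handler n) (E : Sig) : CType → Set where
    heq : ∀ {B E'} → Γ ⊢h H ∶ E ⇒ B ! E' → Γ ⊢h H' ∶ E ⇒ B ! E'
        → Γ ⊢cl H ≈ H' ∶ E ⇒ B ! E' → Γ ⊢h H ≈ H' ∶ E ⇒ B ! E'

  data _⊢cl_≈_∶_⇒_ {n} (Γ : Ctx n) : Handler n → Handler n → Sig → CType → Set where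
    []  : ∀ {E D} → Γ ⊢cl [] ≈ [] ∶ E ⇒ D
    _∷_ : ∀ {op Mop Mop' H H' Aop Bop B E E'}
        → ((op , Aop , Bop) ∈ E × ((Bop ⇒ B ! E') ,, (Aop ,, Γ)) ⊢c Mop ≈ Mop' ∶ B ! E')
        → Γ ⊢cl H ≈ H' ∶ E ⇒ B ! E'
        → Γ ⊢cl ((op , Mop) ∷ H) ≈ ((op , Mop') ∷ H') ∶ E ⇒ B ! E'

-- The left-hand side is M[V/x] for M = handle (case x of {ι₁x₁ ↦ M₁; ι₂x₂ ↦ M₂}) with H to y.N,
-- x fresh.  The η-law for sums turns M[V/x] into case V of {ι₁x₁ ↦ M[ι₁x₁/x]; ι₂x₂ ↦ M[ι₂x₂/x]},
-- and in the i-th branch β for sums, applied under the handler, reduces case ιᵢxᵢ of {…} to Mᵢ.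
module Submission where

open import Data.Nat using (suc)
open import Data.Fin using (zero; suc)
open import Data.List using ([]; _∷_)
open import Data.List.Relation.Unary.Any using (here; there)
open import Data.List.Relation.Unary.Unique.Propositional using (Unique)
open import Data.List.Membership.Propositional using (_∈_)
open import Data.Product using (_×_; _,_; ∃-syntax)
open import Data.Vec using (lookup) renaming (_∷_ to _,,_)
open import Function using (id)
open import Relation.Binary.PropositionalEquality
  using (_≡_; refl; sym; trans; cong; cong₂; subst; subst₂)
open import Defs

cong₃ : ∀ {A B C D : Set} (f : A → B → C → D) {x x′ y y′ z z′}
      → x ≡ x′ → y ≡ y′ → z ≡ z′ → f x y z ≡ f x′ y′ z′
cong₃ f refl refl refl = refl

liftS-liftR : ∀ {n m k} {σ : Sub m k} {ρ : Ren n m} {ρ′ : Ren n k}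
            → (∀ i → σ (ρ i) ≡ var (ρ′ i))
            → ∀ i → liftS σ (liftR ρ i) ≡ var (liftR ρ′ i)
liftS-liftR eq zero    = refl
liftS-liftR eq (suc i) = cong wkV (eq i)

mutual
  subV-renV : ∀ {n m k} {σ : Sub m k} {ρ : Ren n m} {ρ′ : Ren n k}
            → (∀ i → σ (ρ i) ≡ var (ρ′ i)) → ∀ V → subV σ (renV ρ V) ≡ renV ρ′ V
  subV-renV eq (var i)    = eq i
  subV-renV eq (lam M)    = cong lam (subC-renC (liftS-liftR eq) M)
  subV-renV eq (tup Vs)   = cong tup (subVs-renVs eq Vs)
  subV-renV eq (proj i V) = cong (proj i) (subV-renV eq V)
  subV-renV eq (inl V)    = cong inl (subV-renV eq V)
  subV-renV eq (inr V)    = cong inr (subV-renV eq V)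

  subVs-renVs : ∀ {n m k} {σ : Sub m k} {ρ : Ren n m} {ρ′ : Ren n k}
              → (∀ i → σ (ρ i) ≡ var (ρ′ i)) → ∀ Vs → subVs σ (renVs ρ Vs) ≡ renVs ρ′ Vs
  subVs-renVs eq []       = refl
  subVs-renVs eq (V ∷ Vs) = cong₂ _∷_ (subV-renV eq V) (subVs-renVs eq Vs)

  subC-renC : ∀ {n m k} {σ : Sub m k} {ρ : Ren n m} {ρ′ : Ren n k}
            → (∀ i → σ (ρ i) ≡ var (ρ′ i)) → ∀ M → subC σ (renC ρ M) ≡ renC ρ′ M
  subC-renC eq (app V W)      = cong₂ app (subV-renV eq V) (subV-renV eq W)
  subC-renC eq (ret V)        = cong ret (subV-renV eq V)
  subC-renC eq (lett M N)     = cong₂ lett (subC-renC eq M) (subC-renC (liftS-liftR eq) N)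
  subC-renC eq (opc op V)     = cong (opc op) (subV-renV eq V)
  subC-renC eq (handle M H N) =
    cong₃ handle (subC-renC eq M) (subH-renH eq H) (subC-renC (liftS-liftR eq) N)
  subC-renC eq (case V M N)   =
    cong₃ case (subV-renV eq V) (subC-renC (liftS-liftR eq) M) (subC-renC (liftS-liftR eq) N)

  subH-renH : ∀ {n m k} {σ : Sub m k} {ρ : Ren n m} {ρ′ : Ren n k}
            → (∀ i → σ (ρ i) ≡ var (ρ′ i)) → ∀ H → subH σ (renH ρ H) ≡ renH ρ′ H
  subH-renH eq []             = refl
  subH-renH eq ((op , M) ∷ H) =
    cong₂ _∷_ (cong (op ,_) (subC-renC (liftS-liftR (liftS-liftR eq)) M)) (subH-renH eq H)

liftR-id : ∀ {n} {ρ : Ren n n} → (∀ i → ρ i ≡ i) → ∀ i → liftR ρ i ≡ i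
liftR-id eq zero    = refl
liftR-id eq (suc i) = cong suc (eq i)

mutual
  renV-id : ∀ {n} {ρ : Ren n n} → (∀ i → ρ i ≡ i) → ∀ V → renV ρ V ≡ V
  renV-id eq (var i)    = cong var (eq i)
  renV-id eq (lam M)    = cong lam (renC-id (liftR-id eq) M)
  renV-id eq (tup Vs)   = cong tup (renVs-id eq Vs)
  renV-id eq (proj i V) = cong (proj i) (renV-id eq V)
  renV-id eq (inl V)    = cong inl (renV-id eq V)
  renV-id eq (inr V)    = cong inr (renV-id eq V)

  renVs-id : ∀ {n} {ρ : Ren n n} → (∀ i → ρ i ≡ i) → ∀ Vs → renVs ρ Vs ≡ Vs
  renVs-id eq []       = refl
  renVs-id eq (V ∷ Vs) = cong₂ _∷_ (renV-id eq V) (renVs-id eq Vs)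

  renC-id : ∀ {n} {ρ : Ren n n} → (∀ i → ρ i ≡ i) → ∀ M → renC ρ M ≡ M
  renC-id eq (app V W)      = cong₂ app (renV-id eq V) (renV-id eq W)
  renC-id eq (ret V)        = cong ret (renV-id eq V)
  renC-id eq (lett M N)     = cong₂ lett (renC-id eq M) (renC-id (liftR-id eq) N)
  renC-id eq (opc op V)     = cong (opc op) (renV-id eq V)
  renC-id eq (handle M H N) = cong₃ handle (renC-id eq M) (renH-id eq H) (renC-id (liftR-id eq) N)
  renC-id eq (case V M N)   =
    cong₃ case (renV-id eq V) (renC-id (liftR-id eq) M) (renC-id (liftR-id eq) N)

  renH-id : ∀ {n} {ρ : Ren n n} → (∀ i → ρ i ≡ i) → ∀ H → renH ρ H ≡ H
  renH-id eq []             = refl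
  renH-id eq ((op , M) ∷ H) =
    cong₂ _∷_ (cong (op ,_) (renC-id (liftR-id (liftR-id eq)) M)) (renH-id eq H)

wk₁-[var-zero] : ∀ {n} (M : Comp (suc n)) → wk₁ M [ var zero ] ≡ M
wk₁-[var-zero] M = trans (subC-renC {ρ′ = id} eq M) (renC-id (λ _ → refl) M)
  where
  eq : ∀ i → single (var zero) (liftR suc i) ≡ var i
  eq zero    = refl
  eq (suc i) = refl

TypedRen : ∀ {n m} → Ren n m → Ctx n → Ctx m → Set
TypedRen ρ Γ Δ = ∀ i → lookup Δ (ρ i) ≡ lookup Γ i

TypedRen-lift : ∀ {n m} {Γ : Ctx n} {Δ : Ctx m} {ρ} {A}
              → TypedRen ρ Γ Δ → TypedRen (liftR ρ) (A ,, Γ) (A ,, Δ)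
TypedRen-lift eq zero    = refl
TypedRen-lift eq (suc i) = eq i

TypedRen-wk : ∀ {n} {Γ : Ctx n} {A} → TypedRen suc Γ (A ,, Γ)
TypedRen-wk i = refl

names-renH : ∀ {n m} (ρ : Ren n m) (H : Handler n) → names (renH ρ H) ≡ names H
names-renH ρ []             = refl
names-renH ρ ((op , M) ∷ H) = cong (op ∷_) (names-renH ρ H)

∈-renH⁻ : ∀ {n m} (ρ : Ren n m) (H : Handler n) {op Mop} → (op , Mop) ∈ renH ρ H
        → ∃[ M ] ((op , M) ∈ H × Mop ≡ renC (liftR (liftR ρ)) M)
∈-renH⁻ ρ ((op , M) ∷ H) (here refl) = M , here refl , refl
∈-renH⁻ ρ (_ ∷ H)        (there p) with ∈-renH⁻ ρ H p
... | M , q , eq = M , there q , eq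

mutual
  ⊢v-ren : ∀ {n m} {Γ : Ctx n} {Δ : Ctx m} {ρ} → TypedRen ρ Γ Δ
         → ∀ {V A} → Γ ⊢v V ∶ A → Δ ⊢v renV ρ V ∶ A
  ⊢v-ren {Δ = Δ} {ρ} eq (tvar i) = subst (Δ ⊢v var (ρ i) ∶_) (eq i) (tvar (ρ i))
  ⊢v-ren eq (tlam ⊢M)     = tlam (⊢c-ren (TypedRen-lift eq) ⊢M)
  ⊢v-ren eq (ttup ⊢Vs)    = ttup (⊢vs-ren eq ⊢Vs)
  ⊢v-ren eq (tproj ⊢V p)  = tproj (⊢v-ren eq ⊢V) p
  ⊢v-ren eq (tinl ⊢V)     = tinl (⊢v-ren eq ⊢V)
  ⊢v-ren eq (tinr ⊢V)     = tinr (⊢v-ren eq ⊢V)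

  ⊢vs-ren : ∀ {n m} {Γ : Ctx n} {Δ : Ctx m} {ρ} → TypedRen ρ Γ Δ
          → ∀ {Vs As} → Γ ⊢vs Vs ∶ As → Δ ⊢vs renVs ρ Vs ∶ As
  ⊢vs-ren eq []         = []
  ⊢vs-ren eq (⊢V ∷ ⊢Vs) = ⊢v-ren eq ⊢V ∷ ⊢vs-ren eq ⊢Vs

  ⊢c-ren : ∀ {n m} {Γ : Ctx n} {Δ : Ctx m} {ρ} → TypedRen ρ Γ Δ
         → ∀ {M C} → Γ ⊢c M ∶ C → Δ ⊢c renC ρ M ∶ C
  ⊢c-ren eq (tapp ⊢V ⊢W)        = tapp (⊢v-ren eq ⊢V) (⊢v-ren eq ⊢W)
  ⊢c-ren eq (tret ⊢V)           = tret (⊢v-ren eq ⊢V)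
  ⊢c-ren eq (tlet ⊢M ⊢N)        = tlet (⊢c-ren eq ⊢M) (⊢c-ren (TypedRen-lift eq) ⊢N)
  ⊢c-ren eq (top p ⊢V)          = top p (⊢v-ren eq ⊢V)
  ⊢c-ren eq (thandle ⊢M ⊢H ⊢N)  =
    thandle (⊢c-ren eq ⊢M) (⊢h-ren eq ⊢H) (⊢c-ren (TypedRen-lift eq) ⊢N)
  ⊢c-ren eq (tcase ⊢V ⊢M ⊢N)    =
    tcase (⊢v-ren eq ⊢V) (⊢c-ren (TypedRen-lift eq) ⊢M) (⊢c-ren (TypedRen-lift eq) ⊢N)

  ⊢h-ren : ∀ {n m} {Γ : Ctx n} {Δ : Ctx m} {ρ} → TypedRen ρ Γ Δ
         → ∀ {H E C} → Γ ⊢h H ∶ E ⇒ C → Δ ⊢h renH ρ H ∶ E ⇒ C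
  ⊢h-ren {Δ = Δ} {ρ} eq {H} {E} (thandler {B} {E′} unique clauses forward) =
    thandler (subst Unique names-eq unique) clauses′
      (λ {op} p op∉ → forward p (λ op∈ → op∉ (subst (op ∈_) names-eq op∈)))
    where
    names-eq : names H ≡ names (renH ρ H)
    names-eq = sym (names-renH ρ H)

    clauses′ : ∀ {op Mop} → (op , Mop) ∈ renH ρ H
             → ∃[ Aop ] ∃[ Bop ] ((op , Aop , Bop) ∈ E × ((Bop ⇒ B ! E′) ,, (Aop ,, Δ)) ⊢c Mop ∶ B ! E′)
    clauses′ p with ∈-renH⁻ ρ H p
    ... | M , q , refl with clauses q
    ... | Aop , Bop , r , ⊢M = Aop , Bop , r , ⊢c-ren (TypedRen-lift (TypedRen-lift eq)) ⊢M

⊢c-wk₁ : ∀ {n} {Γ : Ctx n} {A X M C} → (A ,, Γ) ⊢c M ∶ C → (A ,, (X ,, Γ)) ⊢c wk₁ M ∶ C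
⊢c-wk₁ {Γ = Γ} {X = X} = ⊢c-ren (TypedRen-lift (TypedRen-wk {Γ = Γ} {X}))

⊢h-wk : ∀ {n} {Γ : Ctx n} {X H E C} → Γ ⊢h H ∶ E ⇒ C → (X ,, Γ) ⊢h wkH H ∶ E ⇒ C
⊢h-wk {Γ = Γ} {X} = ⊢h-ren (TypedRen-wk {Γ = Γ} {X})

⊢h-refl : ∀ {n} {Γ : Ctx n} {H E C} → Γ ⊢h H ∶ E ⇒ C → Γ ⊢h H ≈ H ∶ E ⇒ C
⊢h-refl {H = H} ⊢H@(thandler _ clauses _) = heq ⊢H ⊢H (⊢cl-refl H clauses)
  where
  ⊢cl-refl : ∀ {n} {Γ : Ctx n} {E B E′} (H : Handler n)
           → (∀ {op Mop} → (op , Mop) ∈ H →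
               ∃[ Aop ] ∃[ Bop ] ((op , Aop , Bop) ∈ E × ((Bop ⇒ B ! E′) ,, (Aop ,, Γ)) ⊢c Mop ∶ B ! E′))
           → Γ ⊢cl H ≈ H ∶ E ⇒ B ! E′
  ⊢cl-refl []      clauses = []
  ⊢cl-refl (_ ∷ H) clauses with clauses (here refl)
  ... | _ , _ , r , ⊢M = (r , refl-c ⊢M) ∷ ⊢cl-refl H (λ p → clauses (there p))

cong-handleˡ : ∀ {n} {Γ : Ctx n} {M M′ H N A B E E′}
             → Γ ⊢c M ≈ M′ ∶ A ! E → Γ ⊢h H ∶ E ⇒ B ! E′ → (A ,, Γ) ⊢c N ∶ B ! E′
             → Γ ⊢c handle M H N ≈ handle M′ H N ∶ B ! E′
cong-handleˡ M≈M′ ⊢H ⊢N = cong-handle M≈M′ (⊢h-refl ⊢H) (refl-c ⊢N)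

handle-case-var : ∀ {n} → Comp (suc n) → Comp (suc n) → Handler n → Comp (suc n) → Comp (suc n)
handle-case-var M₁ M₂ H N = handle (case (var zero) (wk₁ M₁) (wk₁ M₂)) (wkH H) (wk₁ N)

subC-handle-case-var : ∀ {n m} {σ : Sub (suc n) m} {ρ : Ren n m}
  → (∀ i → σ (suc i) ≡ var (ρ i)) → ∀ M₁ M₂ H N
  → subC σ (handle-case-var M₁ M₂ H N)
    ≡ handle (case (σ zero) (renC (liftR ρ) M₁) (renC (liftR ρ) M₂)) (renH ρ H) (renC (liftR ρ) N)
subC-handle-case-var eq M₁ M₂ H N =
  cong₃ handle (cong₂ (case _) (subC-wk₁ M₁) (subC-wk₁ M₂)) (subH-renH eq H) (subC-wk₁ N)
  where
  subC-wk₁ : ∀ M → subC (liftS _) (wk₁ M) ≡ renC (liftR _) M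
  subC-wk₁ = subC-renC (liftS-liftR eq)

handle-case-η : ∀ {n} {Γ : Ctx n} {V M₁ M₂ H N A B A′ E B′ E′}
  → Γ ⊢v V ∶ A ⊕ B → (A ,, Γ) ⊢c M₁ ∶ A′ ! E → (B ,, Γ) ⊢c M₂ ∶ A′ ! E
  → Γ ⊢h H ∶ E ⇒ B′ ! E′ → (A′ ,, Γ) ⊢c N ∶ B′ ! E′
  → Γ ⊢c handle (case V M₁ M₂) H N
       ≈ case V (handle (case (inl (var zero)) (wk₁ M₁) (wk₁ M₂)) (wkH H) (wk₁ N))
                (handle (case (inr (var zero)) (wk₁ M₁) (wk₁ M₂)) (wkH H) (wk₁ N)) ∶ B′ ! E′
handle-case-η {Γ = Γ} {V} {M₁} {M₂} {H} {N} {B′ = B′} {E′} ⊢V ⊢M₁ ⊢M₂ ⊢H ⊢N =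
  subst₂ (Γ ⊢c_≈_∶ B′ ! E′) at-V (cong₂ (case V) at-inl at-inr) (sym-c (η-case ⊢V ⊢M))
  where
  ⊢M : (_ ,, Γ) ⊢c handle-case-var M₁ M₂ H N ∶ B′ ! E′
  ⊢M = thandle (tcase (tvar zero) (⊢c-wk₁ ⊢M₁) (⊢c-wk₁ ⊢M₂)) (⊢h-wk ⊢H) (⊢c-wk₁ ⊢N)

  renC-liftR-id : ∀ M → renC (liftR id) M ≡ M
  renC-liftR-id = renC-id (liftR-id (λ _ → refl))

  at-V : handle-case-var M₁ M₂ H N [ V ] ≡ handle (case V M₁ M₂) H N
  at-V = trans (subC-handle-case-var {ρ = id} (λ _ → refl) M₁ M₂ H N)
               (cong₃ handle (cong₂ (case V) (renC-liftR-id M₁) (renC-liftR-id M₂))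
                             (renH-id (λ _ → refl) H) (renC-liftR-id N))

  at-inl : subC inlSub (handle-case-var M₁ M₂ H N)
         ≡ handle (case (inl (var zero)) (wk₁ M₁) (wk₁ M₂)) (wkH H) (wk₁ N)
  at-inl = subC-handle-case-var (λ _ → refl) M₁ M₂ H N

  at-inr : subC inrSub (handle-case-var M₁ M₂ H N)
         ≡ handle (case (inr (var zero)) (wk₁ M₁) (wk₁ M₂)) (wkH H) (wk₁ N)
  at-inr = subC-handle-case-var (λ _ → refl) M₁ M₂ H N

β-case₁-var : ∀ {n} {Γ : Ctx n} {M₁ M₂ A B C}
  → (A ,, Γ) ⊢c M₁ ∶ C → (B ,, Γ) ⊢c M₂ ∶ C
  → (A ,, Γ) ⊢c case (inl (var zero)) (wk₁ M₁) (wk₁ M₂) ≈ M₁ ∶ C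
β-case₁-var {Γ = Γ} {M₁} {M₂} {A} ⊢M₁ ⊢M₂ =
  subst (A ,, Γ ⊢c case (inl (var zero)) (wk₁ M₁) (wk₁ M₂) ≈_∶ _) (wk₁-[var-zero] M₁)
    (β-case₁ (tvar zero) (⊢c-wk₁ ⊢M₁) (⊢c-wk₁ ⊢M₂))

β-case₂-var : ∀ {n} {Γ : Ctx n} {M₁ M₂ A B C}
  → (A ,, Γ) ⊢c M₁ ∶ C → (B ,, Γ) ⊢c M₂ ∶ C
  → (B ,, Γ) ⊢c case (inr (var zero)) (wk₁ M₁) (wk₁ M₂) ≈ M₂ ∶ C
β-case₂-var {Γ = Γ} {M₁} {M₂} {B = B} ⊢M₁ ⊢M₂ =
  subst (B ,, Γ ⊢c case (inr (var zero)) (wk₁ M₁) (wk₁ M₂) ≈_∶ _) (wk₁-[var-zero] M₂)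
    (β-case₂ (tvar zero) (⊢c-wk₁ ⊢M₁) (⊢c-wk₁ ⊢M₂))

proposition4p12 : ∀ {n} (Γ : Ctx n) (V : Val n) (M₁ M₂ : Comp (suc n)) (H : Handler n)
                      (N : Comp (suc n)) (C : CType)
    → Γ ⊢c handle (case V M₁ M₂) H N ∶ C
    → Γ ⊢c handle (case V M₁ M₂) H N
         ≈ case V (handle M₁ (wkH H) (wk₁ N)) (handle M₂ (wkH H) (wk₁ N)) ∶ C
proposition4p12 Γ V M₁ M₂ H N C (thandle (tcase ⊢V ⊢M₁ ⊢M₂) ⊢H ⊢N) =
  trans-c (handle-case-η ⊢V ⊢M₁ ⊢M₂ ⊢H ⊢N)
    (cong-case (refl-v ⊢V)
      (cong-handleˡ (β-case₁-var ⊢M₁ ⊢M₂) (⊢h-wk ⊢H) (⊢c-wk₁ ⊢N))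
      (cong-handleˡ (β-case₂-var ⊢M₁ ⊢M₂) (⊢h-wk ⊢H) (⊢c-wk₁ ⊢N)))
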